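{- Let $m > n \ge 1$ be relatively prime integers of opposite parity, so that $(m^2-n^2,\,2mn,\,m^2+n^2)$ is a primitive Pythagorean triple. Then \[ g(m^2-n^2,\,2mn,\,m^2+n^2) = (m-1)(m^2-n^2) + (m-1)(2mn) - (m^2+n^2). \]
   Context: For relatively prime positive integers $a_1,\dots,a_k$, the Frobenius number $g(a_1,\dots,a_k)$ is the largest integer that cannot be written as $x_1a_1+\dots+x_ka_k$ with all $x_i$ nonnegative integers. -}

module Defs where

open import Data.Nat using (ℕ)
open import Data.Integer using (ℤ; +_; _+_; _*_; _≤_)
open import Data.Product using (∃; ∃-syntax; _×_)
open import Relation.Binary.PropositionalEquality using (_≡_)
open import Relation.Nullary using (¬_)

Representable₃ : ℕ → ℕ → ℕ → ℤ → Set
Representable₃ a b c z =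
  ∃[ x ] ∃[ y ] ∃[ w ] (z ≡ (+ x) * (+ a) + (+ y) * (+ b) + (+ w) * (+ c))

IsFrobenius₃ : ℕ → ℕ → ℕ → ℤ → Set
IsFrobenius₃ a b c g =
  (¬ Representable₃ a b c g) × (∀ z → ¬ Representable₃ a b c z → z ≤ g)

{-# OPTIONS --safe #-}
-- Write a = m² − n², b = 2mn, c = m² + n² and g = (m − 1)(a + b) − c; then a + bi = (m + ni)²
-- and c = (m + ni)(m − ni).
--
-- g is not representable: from g = xa + yb + wc, the numbers u = m − 1 − x and v = m − 1 − y
-- satisfy ua + vb = (w + 1)c. Since c is coprime to 2m and 2n, this forces
-- u + vi = (p + qi)(m + ni) and w + 1 = pm + qn for integers p, q, and a sign analysis shows
-- that u, v < m is incompatible with pm + qn > 0.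
--
-- Every z > g is representable: a is invertible modulo c, so z = xa + kc with x ≥ 0. The
-- relations ma + nb = mc and (m + n)a = (m − n)(b + c) trade a's and b's for c's until
-- x < m, y < m or x < m + n, y < n, where xa + yb ≤ (m − 1)(a + b). If the coefficient of c
-- is still negative, z ≤ (m − 1)(a + b) − c = g.
module Submission where

open import Defs
open import Data.Nat using (ℕ)
open import Data.Product using (∃-syntax; _×_; _,_)
open import Data.Sum using (_⊎_; inj₁; inj₂)
open import Relation.Nullary using (¬_; yes; no; contradiction)
open import Relation.Binary.PropositionalEquality

module _ where
  open import Data.Nat
  open import Data.Nat.Properties
  open import Data.Nat.Divisibility
  open import Data.Nat.DivMod
  open import Data.Nat.Coprimality using (Coprime; coprime-divisor)
  open import Data.Nat.Primality using (irreducible[2])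
  open import Data.Nat.Induction using (<-wellFounded)
  open import Data.Nat.Tactic.RingSolver using (solve-∀)
  open import Induction.WellFounded using (Acc; acc)

  coprime-∣ : ∀ {d x y} → d ∣ x → Coprime x y → Coprime d y
  coprime-∣ d∣x cxy (e∣d , e∣y) = cxy (∣-trans e∣d d∣x , e∣y)

  coprime-* : ∀ {x y z} → Coprime x y → Coprime x z → Coprime x (y * z)
  coprime-* cxy cxz (d∣x , d∣yz) = cxz (d∣x , coprime-divisor (coprime-∣ d∣x cxy) d∣yz)

  ¬2∣⇒coprime-2 : ∀ {x} → ¬ 2 ∣ x → Coprime x 2
  ¬2∣⇒coprime-2 2∤x (d∣x , d∣2) with irreducible[2] d∣2
  ... | inj₁ d≡1 = d≡1
  ... | inj₂ refl = contradiction d∣x 2∤x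

  m^2%2≡m%2 : ∀ m → m ^ 2 % 2 ≡ m % 2
  m^2%2≡m%2 m = begin
    m * (m * 1) % 2       ≡⟨ cong (λ k → m * k % 2) (*-identityʳ m) ⟩
    m * m % 2             ≡⟨ %-distribˡ-* m m 2 ⟩
    m % 2 * (m % 2) % 2   ≡⟨ bit-square (m%n<n m 2) ⟩
    m % 2                 ∎
    where
    open ≡-Reasoning
    bit-square : ∀ {r} → r < 2 → r * r % 2 ≡ r
    bit-square {0} _ = refl
    bit-square {1} _ = refl
    bit-square {2+ _} (s≤s (s≤s ()))

  sum-of-squares-odd : ∀ m n → m % 2 ≢ n % 2 → ¬ 2 ∣ m ^ 2 + n ^ 2
  sum-of-squares-odd m n m≢n 2∣c = distinct-bits-sum (m%n<n m 2) (m%n<n n 2) m≢n (begin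
    (m % 2 + n % 2) % 2           ≡⟨ cong₂ (λ r s → (r + s) % 2) (m^2%2≡m%2 m) (m^2%2≡m%2 n) ⟨
    (m ^ 2 % 2 + n ^ 2 % 2) % 2   ≡⟨ %-distribˡ-+ (m ^ 2) (n ^ 2) 2 ⟨
    (m ^ 2 + n ^ 2) % 2           ≡⟨ n∣m⇒m%n≡0 _ 2 2∣c ⟩
    0                             ∎)
    where
    open ≡-Reasoning
    distinct-bits-sum : ∀ {r s} → r < 2 → s < 2 → r ≢ s → (r + s) % 2 ≢ 0
    distinct-bits-sum {0} {0} _ _ r≢s _ = r≢s refl
    distinct-bits-sum {1} {1} _ _ r≢s _ = r≢s refl
    distinct-bits-sum {0} {1} _ _ _ ()
    distinct-bits-sum {1} {0} _ _ _ ()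
    distinct-bits-sum {2+ _} (s≤s (s≤s ()))
    distinct-bits-sum {_} {2+ _} _ (s≤s (s≤s ()))

  sum-of-squares-coprime : ∀ {m n} → Coprime m n → Coprime (m ^ 2 + n ^ 2) m
  sum-of-squares-coprime {m} {n} cmn {d} (d∣c , d∣m) = cmn (d∣m , d∣n)
    where
    d∣n : d ∣ n
    d∣n = subst (d ∣_) (*-identityʳ n)
      (coprime-divisor (coprime-∣ d∣m cmn) (∣m+n∣m⇒∣n d∣c (∣m⇒∣m*n (m * 1) d∣m)))

  -- Here m = 1 + n + d. The pairs satisfying Reduced index the Apéry set of c in ⟨a, b, c⟩.
  module Reduction (n d a b c : ℕ)
    (syzygy₁ : suc (n + d) * a + n * b ≡ suc (n + d) * c)
    (syzygy₂ : (suc (n + d) + n) * a ≡ suc d * b + suc d * c) where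

    private
      m = suc (n + d)

    Reduced : ℕ → ℕ → Set
    Reduced x y = (x < m × y < m) ⊎ (x < m + n × y < n)

    Reduces : ℕ → ℕ → Set
    Reduces x y = ∃[ x' ] ∃[ y' ] ∃[ j ] Reduced x' y' × x * a + y * b ≡ x' * a + y' * b + j * c

    private
      add-c : ∀ x y x' y' j k → x * a + y * b ≡ x' * a + y' * b + j * c →
              x * a + y * b + k * c ≡ x' * a + y' * b + (j + k) * c
      add-c x y x' y' j k eq = trans (cong (_+ k * c) eq) (lemma x' y' j k a b c)
        where
        lemma : ∀ x' y' j k a b c → x' * a + y' * b + j * c + k * c ≡ x' * a + y' * b + (j + k) * c
        lemma = solve-∀

      trade₁ : ∀ {x y} → Reduces x y → Reduces (m + x) (n + y)
      trade₁ {x} {y} (x' , y' , j , r , eq) = x' , y' , j + m , r , (begin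
        (m + x) * a + (n + y) * b         ≡⟨ lemma m n x y a b ⟩
        x * a + y * b + (m * a + n * b)   ≡⟨ cong (x * a + y * b +_) syzygy₁ ⟩
        x * a + y * b + m * c             ≡⟨ add-c x y x' y' j m eq ⟩
        x' * a + y' * b + (j + m) * c     ∎)
        where
        open ≡-Reasoning
        lemma : ∀ m n x y a b → (m + x) * a + (n + y) * b ≡ x * a + y * b + (m * a + n * b)
        lemma = solve-∀

      trade₂ : ∀ {x y} → Reduces x (y + suc d) → Reduces (m + n + x) y
      trade₂ {x} {y} (x' , y' , j , r , eq) = x' , y' , j + suc d , r , (begin
        (m + n + x) * a + y * b                 ≡⟨ lemma (m + n) x y a b ⟩
        x * a + y * b + (m + n) * a             ≡⟨ cong (x * a + y * b +_) syzygy₂ ⟩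
        x * a + y * b + (suc d * b + suc d * c) ≡⟨ lemma′ x y (suc d) a b c ⟩
        x * a + (y + suc d) * b + suc d * c     ≡⟨ add-c x (y + suc d) x' y' j (suc d) eq ⟩
        x' * a + y' * b + (j + suc d) * c       ∎)
        where
        open ≡-Reasoning
        lemma : ∀ l x y a b → (l + x) * a + y * b ≡ x * a + y * b + l * a
        lemma = solve-∀
        lemma′ : ∀ x y k a b c → x * a + y * b + (k * b + k * c) ≡ x * a + (y + k) * b + k * c
        lemma′ = solve-∀

      done : ∀ {x y} → Reduced x y → Reduces x y
      done {x} {y} r = x , y , 0 , r , sym (+-identityʳ (x * a + y * b))

      reduce-acc : ∀ x y → y < m → Acc _<_ x → Reduces x y
      reduce-acc x y y<m (acc rec) with x <? m | n ≤? y | x <? m + n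
      ... | yes x<m | _ | _ = done (inj₁ (x<m , y<m))
      ... | no _ | no n≰y | yes x<m+n = done (inj₂ (x<m+n , ≰⇒> n≰y))
      ... | no x≮m | yes n≤y | _
        with x₁ , refl ← m≤n⇒∃[o]m+o≡n (≮⇒≥ x≮m) | y₁ , refl ← m≤n⇒∃[o]m+o≡n n≤y
        = trade₁ (reduce-acc x₁ y₁ (≤-<-trans (m≤n+m y₁ n) y<m) (rec (m<n+m x₁ z<s)))
      ... | no _ | no n≰y | no x≮m+n
        with x₂ , refl ← m≤n⇒∃[o]m+o≡n (≮⇒≥ x≮m+n)
        = trade₂ {y = y} (reduce-acc x₂ (y + suc d)
            (subst (y + suc d <_) (+-suc n d) (+-monoˡ-< (suc d) (≰⇒> n≰y))) (rec (m<n+m x₂ {m + n} z<s)))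

    reduce : ∀ x y → y < m → Reduces x y
    reduce x y y<m = reduce-acc x y y<m (<-wellFounded x)

    reduced-bound : n * a ≤ suc d * b → ∀ {x y} → Reduced x y →
                    x * a + y * b ≤ (n + d) * a + (n + d) * b
    reduced-bound _ (inj₁ (s≤s x≤ , s≤s y≤)) = +-mono-≤ (*-monoˡ-≤ a x≤) (*-monoˡ-≤ b y≤)
    reduced-bound na≤kb {x} {y} (inj₂ (s≤s x≤ , y<n)) = +-cancelʳ-≤ b _ _ (begin
      x * a + y * b + b               ≡⟨ lemma₁ x y a b ⟩
      x * a + suc y * b               ≤⟨ +-mono-≤ (*-monoˡ-≤ a x≤) (*-monoˡ-≤ b y<n) ⟩
      (n + d + n) * a + n * b         ≡⟨ lemma₂ n d a b ⟩
      (n + d) * a + n * b + n * a     ≤⟨ +-monoʳ-≤ ((n + d) * a + n * b) na≤kb ⟩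
      (n + d) * a + n * b + suc d * b ≡⟨ lemma₃ n d a b ⟩
      (n + d) * a + (n + d) * b + b   ∎)
      where
      open ≤-Reasoning
      lemma₁ : ∀ x y a b → x * a + y * b + b ≡ x * a + suc y * b
      lemma₁ = solve-∀
      lemma₂ : ∀ n d a b → (n + d + n) * a + n * b ≡ (n + d) * a + n * b + n * a
      lemma₂ = solve-∀
      lemma₃ : ∀ n d a b → (n + d) * a + n * b + suc d * b ≡ (n + d) * a + (n + d) * b + b
      lemma₃ = solve-∀

module _ where
  open import Data.Nat as ℕ using (ℕ; s≤s; z≤n)
  open import Data.Nat.Properties as ℕ using (m≤n⇒∃[o]m+o≡n)
  open import Data.Nat.Coprimality as ℕ using (coprime-Bézout)
  open import Data.Nat.GCD using (module Bézout)
  open import Data.Integer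
  open import Data.Integer.Properties
  open import Data.Integer.Coprimality using (Coprime; coprime-divisor)
  open import Data.Integer.Divisibility.Signed using (_∣_; divides; quotient; ∣ᵤ⇒∣; ∣⇒∣ᵤ)
  open import Data.Integer.DivMod using (_/ℕ_; _%ℕ_; a≡a%ℕn+[a/ℕn]*n)
  open import Data.Integer.Tactic.RingSolver using (solve-∀)

  pos-square : ∀ x → + (x ℕ.^ 2) ≡ + x * + x
  pos-square x = trans (cong (λ t → + (x ℕ.* t)) (ℕ.*-identityʳ x)) (pos-* x x)

  pos-combination₂ : ∀ x a y b → + (x ℕ.* a ℕ.+ y ℕ.* b) ≡ + x * + a + + y * + b
  pos-combination₂ x a y b = trans (pos-+ (x ℕ.* a) (y ℕ.* b)) (cong₂ _+_ (pos-* x a) (pos-* y b))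

  pos-combination₃ : ∀ x a y b w c →
    + (x ℕ.* a ℕ.+ y ℕ.* b ℕ.+ w ℕ.* c) ≡ + x * + a + + y * + b + + w * + c
  pos-combination₃ x a y b w c =
    trans (pos-+ (x ℕ.* a ℕ.+ y ℕ.* b) (w ℕ.* c)) (cong₂ _+_ (pos-combination₂ x a y b) (pos-* w c))

  -- In ℤ[i]: U + Vi = (p + qi)(M + Ni). The hypothesis says that C = (M + Ni)(M − Ni) divides
  -- the real part of (U − Vi)(M + Ni)², and coprimality lets us cancel the factors 2M and 2N.
  gaussian-multiple : ∀ (M N U V W : ℤ) .{{_ : NonZero (M * M + N * N)}} →
    Coprime (M * M + N * N) (+ 2 * M) → Coprime (M * M + N * N) (+ 2 * N) →
    U * (M * M - N * N) + V * (+ 2 * M * N) ≡ W * (M * M + N * N) →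
    ∃[ p ] ∃[ q ] U ≡ p * M - q * N × V ≡ p * N + q * M × W ≡ p * M + q * N
  gaussian-multiple M N U V W cop₁ cop₂ eq = p , q
    , *-cancelʳ-≡ U (p * M - q * N) C (begin
        U * C                     ≡⟨ UC≡Mα-Nβ M N U V ⟩
        M * α - N * β             ≡⟨ cong₂ (λ s t → M * s - N * t) α≡ β≡ ⟩
        M * (p * C) - N * (q * C) ≡⟨ factor-C⁻ M N p q C ⟩
        (p * M - q * N) * C       ∎)
    , *-cancelʳ-≡ V (p * N + q * M) C (begin
        V * C                     ≡⟨ VC≡Nα+Mβ M N U V ⟩
        N * α + M * β             ≡⟨ cong₂ (λ s t → N * s + M * t) α≡ β≡ ⟩
        N * (p * C) + M * (q * C) ≡⟨ factor-C⁺ N M p q C ⟩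
        (p * N + q * M) * C       ∎)
    , *-cancelʳ-≡ W (p * M + q * N) C (begin
        W * C                     ≡⟨ eq ⟨
        U * A + V * B             ≡⟨ UA+VB≡Mα+Nβ M N U V ⟩
        M * α + N * β             ≡⟨ cong₂ (λ s t → M * s + N * t) α≡ β≡ ⟩
        M * (p * C) + N * (q * C) ≡⟨ factor-C⁺ M N p q C ⟩
        (p * M + q * N) * C       ∎)
    where
    open ≡-Reasoning
    A B C α β : ℤ
    A = M * M - N * N
    B = + 2 * M * N
    C = M * M + N * N
    α = U * M + V * N
    β = V * M - U * N
    2Mα≡UA+VB+UC : ∀ M N U V → + 2 * M * (U * M + V * N) ≡ U * (M * M - N * N) + V * (+ 2 * M * N) + U * (M * M + N * N)
    2Mα≡UA+VB+UC = solve-∀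
    2Nβ≡UA+VB-UC : ∀ M N U V → + 2 * N * (V * M - U * N) ≡ U * (M * M - N * N) + V * (+ 2 * M * N) - U * (M * M + N * N)
    2Nβ≡UA+VB-UC = solve-∀
    UC≡Mα-Nβ : ∀ M N U V → U * (M * M + N * N) ≡ M * (U * M + V * N) - N * (V * M - U * N)
    UC≡Mα-Nβ = solve-∀
    VC≡Nα+Mβ : ∀ M N U V → V * (M * M + N * N) ≡ N * (U * M + V * N) + M * (V * M - U * N)
    VC≡Nα+Mβ = solve-∀
    UA+VB≡Mα+Nβ : ∀ M N U V → U * (M * M - N * N) + V * (+ 2 * M * N) ≡ M * (U * M + V * N) + N * (V * M - U * N)
    UA+VB≡Mα+Nβ = solve-∀
    factor-C⁺ : ∀ X Y p q C → X * (p * C) + Y * (q * C) ≡ (p * X + q * Y) * C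
    factor-C⁺ = solve-∀
    factor-C⁻ : ∀ X Y p q C → X * (p * C) - Y * (q * C) ≡ (p * X - q * Y) * C
    factor-C⁻ = solve-∀
    [W-U]C : ∀ W U C → W * C - U * C ≡ (W - U) * C
    [W-U]C = solve-∀
    2Mα≡ : + 2 * M * α ≡ (W + U) * C
    2Mα≡ = begin
      + 2 * M * α             ≡⟨ 2Mα≡UA+VB+UC M N U V ⟩
      U * A + V * B + U * C   ≡⟨ cong (_+ U * C) eq ⟩
      W * C + U * C           ≡⟨ *-distribʳ-+ C W U ⟨
      (W + U) * C             ∎
    2Nβ≡ : + 2 * N * β ≡ (W - U) * C
    2Nβ≡ = begin
      + 2 * N * β             ≡⟨ 2Nβ≡UA+VB-UC M N U V ⟩
      U * A + V * B - U * C   ≡⟨ cong (_- U * C) eq ⟩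
      W * C - U * C           ≡⟨ [W-U]C W U C ⟩
      (W - U) * C             ∎
    C∣α : C ∣ α
    C∣α = ∣ᵤ⇒∣ (coprime-divisor C (+ 2 * M) α cop₁ (∣⇒∣ᵤ (divides (W + U) 2Mα≡)))
    C∣β : C ∣ β
    C∣β = ∣ᵤ⇒∣ (coprime-divisor C (+ 2 * N) β cop₂ (∣⇒∣ᵤ (divides (W - U) 2Nβ≡)))
    p q : ℤ
    p = quotient C∣α
    q = quotient C∣β
    α≡ : α ≡ p * C
    α≡ = _∣_.equality C∣α
    β≡ : β ≡ q * C
    β≡ = _∣_.equality C∣β

  i<1⇒i≤0 : ∀ {i} → i < 1ℤ → i ≤ 0ℤ
  i<1⇒i≤0 (+<+ (s≤s z≤n)) = +≤+ z≤n
  i<1⇒i≤0 -<+ = -≤+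

  gaussian-multiple-bound : ∀ {m n} (p q : ℤ) → n ℕ.≤ m →
    p * + m - q * + n < + m → p * + n + q * + m < + m → p * + m + q * + n ≤ 0ℤ
  gaussian-multiple-bound {n = n} p q n≤m u<M v<M with m≤n⇒∃[o]m+o≡n n≤m | q ≤? 0ℤ
  ... | k , refl | yes q≤0 = +-mono-≤ (*-monoʳ-≤-nonNeg M p≤0) (*-monoʳ-≤-nonNeg N q≤0)
    where
    N M : ℤ
    N = + n
    M = + (n ℕ.+ k)
    p≤0 : p ≤ 0ℤ
    p≤0 = i<1⇒i≤0 (*-cancelʳ-<-nonNeg M (begin-strict
      p * M           ≡⟨ +-identityʳ (p * M) ⟨
      p * M + 0ℤ      ≤⟨ +-monoʳ-≤ (p * M) (neg-mono-≤ (*-monoʳ-≤-nonNeg N q≤0)) ⟩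
      p * M - q * N   <⟨ u<M ⟩
      M               ≡⟨ *-identityˡ M ⟨
      1ℤ * M          ∎))
      where open ≤-Reasoning
  ... | k , refl | no q≰0 with p + q ≤? 0ℤ
  ...   | yes p+q≤0 = begin
      p * M + q * N         ≡⟨ split p q N K ⟩
      (p + q) * M - q * K   ≤⟨ +-monoʳ-≤ ((p + q) * M) (neg-mono-≤ (*-monoʳ-≤-nonNeg K (<⇒≤ (≰⇒> q≰0)))) ⟩
      (p + q) * M + 0ℤ      ≡⟨ +-identityʳ ((p + q) * M) ⟩
      (p + q) * M           ≤⟨ *-monoʳ-≤-nonNeg M p+q≤0 ⟩
      0ℤ                    ∎
    where
    open ≤-Reasoning
    N K M : ℤ
    N = + n
    K = + k
    M = + (n ℕ.+ k)
    split : ∀ p q N K → p * (N + K) + q * N ≡ (p + q) * (N + K) - q * K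
    split = solve-∀
  ...   | no p+q≰0 = contradiction (<-≤-trans v<M M≤v) (<-irrefl refl)
    where
    open ≤-Reasoning
    N K M : ℤ
    N = + n
    K = + k
    M = + (n ℕ.+ k)
    merge : ∀ p q N K → (p + q) * N + q * K ≡ p * N + q * (N + K)
    merge = solve-∀
    M≤v : M ≤ p * N + q * M
    M≤v = begin
      N + K                 ≡⟨ cong₂ _+_ (*-identityˡ N) (*-identityˡ K) ⟨
      1ℤ * N + 1ℤ * K       ≤⟨ +-mono-≤ (*-monoʳ-≤-nonNeg N (i<j⇒suc[i]≤j (≰⇒> p+q≰0)))
                                        (*-monoʳ-≤-nonNeg K (i<j⇒suc[i]≤j (≰⇒> q≰0))) ⟩
      (p + q) * N + q * K   ≡⟨ merge p q N K ⟩
      p * N + q * (N + K)   ∎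

  1+yc≡xa⇒xa-yc≡1 : ∀ {x a y c} → 1 ℕ.+ y ℕ.* c ≡ x ℕ.* a → + x * + a - + y * + c ≡ 1ℤ
  1+yc≡xa⇒xa-yc≡1 {x} {a} {y} {c} eq = begin
    + x * + a - + y * + c                    ≡⟨ cong₂ _-_ (pos-* x a) (pos-* y c) ⟨
    + (x ℕ.* a) - + (y ℕ.* c)                ≡⟨ cong (λ t → + t - + (y ℕ.* c)) eq ⟨
    1ℤ + + (y ℕ.* c) - + (y ℕ.* c)           ≡⟨ cancel (+ (y ℕ.* c)) ⟩
    1ℤ                                       ∎
    where
    open ≡-Reasoning
    cancel : ∀ t → 1ℤ + t - t ≡ 1ℤ
    cancel = solve-∀

  coprime⇒bézout : ∀ {a c} → ℕ.Coprime a c → ∃[ e ] ∃[ f ] e * + a + f * + c ≡ 1ℤ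
  coprime⇒bézout {a} {c} cop with coprime-Bézout cop
  ... | Bézout.+- x y eq = + x , - + y , trans (swap₁ (+ x) (+ a) (+ y) (+ c)) (1+yc≡xa⇒xa-yc≡1 {x} {a} {y} {c} eq)
    where
    swap₁ : ∀ x a y c → x * a + - y * c ≡ x * a - y * c
    swap₁ = solve-∀
  ... | Bézout.-+ x y eq = - + x , + y , trans (swap₂ (+ x) (+ a) (+ y) (+ c)) (1+yc≡xa⇒xa-yc≡1 {y} {c} {x} {a} eq)
    where
    swap₂ : ∀ x a y c → - x * a + y * c ≡ y * c - x * a
    swap₂ = solve-∀

  coprime⇒residue : ∀ {a c} .{{_ : ℕ.NonZero c}} → ℕ.Coprime a c →
    ∀ z → ∃[ x ] ∃[ k ] z ≡ + x * + a + k * + c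
  coprime⇒residue {a} {c} cop z with coprime⇒bézout cop
  ... | e , f , bézout = x , q * A + z * f , (begin
    z                               ≡⟨ *-identityʳ z ⟨
    z * 1ℤ                          ≡⟨ cong (z *_) bézout ⟨
    z * (e * A + f * C)             ≡⟨ expand z e f A C ⟩
    z * e * A + z * f * C           ≡⟨ cong (λ t → t * A + z * f * C) (a≡a%ℕn+[a/ℕn]*n (z * e) c) ⟩
    (+ x + q * C) * A + z * f * C   ≡⟨ collect (+ x) q z f A C ⟩
    + x * A + (q * A + z * f) * C   ∎)
    where
    open ≡-Reasoning
    A C q : ℤ
    A = + a
    C = + c
    q = (z * e) /ℕ c
    x : ℕ
    x = (z * e) %ℕ c
    expand : ∀ z e f A C → z * (e * A + f * C) ≡ z * e * A + z * f * C
    expand = solve-∀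
    collect : ∀ x q z f A C → (x + q * C) * A + z * f * C ≡ x * A + (q * A + z * f) * C
    collect = solve-∀

-- Setting m = 1 + n + d encodes n < m and makes m ∸ 1 reduce to n + d.
module PythagoreanTriple (n d : ℕ) where

  open import Data.Nat
  open import Data.Nat.Properties
  open import Data.Nat.Divisibility using (_∣_; ∣m∣n⇒∣m+n)
  open import Data.Nat.DivMod using (_%_)
  open import Data.Nat.Coprimality as Coprimality using (Coprime)
  open import Data.Nat.Tactic.RingSolver using (solve-∀)
  import Data.Integer as ℤ

  m a b c : ℕ
  m = suc (n + d)
  a = m ^ 2 ∸ n ^ 2
  b = 2 * m * n
  c = m ^ 2 + n ^ 2

  g : ℤ.ℤ
  g = ℤ.+ ((m ∸ 1) * a + (m ∸ 1) * b) ℤ.- ℤ.+ c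

  a-factors : a ≡ suc d * (m + n)
  a-factors = trans (cong (_∸ n ^ 2) (lemma n d)) (m+n∸m≡n (n ^ 2) _)
    where
    lemma : ∀ n d → (1 + n + d) * ((1 + n + d) * 1) ≡ n * (n * 1) + (1 + d) * ((1 + n + d) + n)
    lemma = solve-∀

  syzygy₁ : m * a + n * b ≡ m * c
  syzygy₁ = trans (cong (λ t → m * t + n * b) a-factors) (lemma n d)
    where
    lemma : ∀ n d → (1 + n + d) * ((1 + d) * ((1 + n + d) + n)) + n * (2 * (1 + n + d) * n)
                  ≡ (1 + n + d) * ((1 + n + d) * ((1 + n + d) * 1) + n * (n * 1))
    lemma = solve-∀

  syzygy₂ : (m + n) * a ≡ suc d * b + suc d * c
  syzygy₂ = trans (cong ((m + n) *_) a-factors) (lemma n d)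
    where
    lemma : ∀ n d → ((1 + n + d) + n) * ((1 + d) * ((1 + n + d) + n))
                  ≡ (1 + d) * (2 * (1 + n + d) * n) + (1 + d) * ((1 + n + d) * ((1 + n + d) * 1) + n * (n * 1))
    lemma = solve-∀

  na≤[1+d]b : n * a ≤ suc d * b
  na≤[1+d]b = subst (n * a ≤_) (sym [1+d]b≡) (m≤m+n (n * a) _)
    where
    lemma : ∀ n d → (1 + d) * (2 * (1 + n + d) * n) ≡ n * ((1 + d) * ((1 + n + d) + n)) + (1 + d) * n * (1 + d)
    lemma = solve-∀
    [1+d]b≡ : suc d * b ≡ n * a + suc d * n * suc d
    [1+d]b≡ = trans (lemma n d) (cong (λ t → n * t + suc d * n * suc d) (sym a-factors))

  open Reduction n d a b c syzygy₁ syzygy₂ public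

  module _ (cop : Coprime m n) (par : m % 2 ≢ n % 2) where

    c-coprime-2m : Coprime c (2 * m)
    c-coprime-2m = coprime-* (¬2∣⇒coprime-2 (sum-of-squares-odd m n par)) (sum-of-squares-coprime cop)

    c-coprime-2n : Coprime c (2 * n)
    c-coprime-2n = coprime-* (¬2∣⇒coprime-2 (sum-of-squares-odd m n par))
      (subst (λ t → Coprime t n) (+-comm (n ^ 2) (m ^ 2)) (sum-of-squares-coprime (Coprimality.sym cop)))

    a-coprime-c : Coprime a c
    a-coprime-c {k} (k∣a , k∣c) =
      coprime-* {c} {2 * m} {m} c-coprime-2m (sum-of-squares-coprime cop) (k∣c , subst (k ∣_) a+c≡2mm (∣m∣n⇒∣m+n k∣a k∣c))
      where
      lemma : ∀ n d → (1 + d) * ((1 + n + d) + n) + ((1 + n + d) * ((1 + n + d) * 1) + n * (n * 1))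
                    ≡ 2 * (1 + n + d) * (1 + n + d)
      lemma = solve-∀
      a+c≡2mm : a + c ≡ 2 * m * m
      a+c≡2mm = trans (cong (_+ c) a-factors) (lemma n d)

module PythagoreanFrobenius (n d : ℕ) where
  open import Data.Nat as ℕ using (s≤s; z≤n)
  open import Data.Nat.Properties as ℕ using ()
  open import Data.Nat.Coprimality as ℕ using ()
  open import Data.Integer hiding (_%_)
  open import Data.Integer.Properties
  open import Data.Integer.Coprimality using (Coprime)
  open import Data.Integer.Tactic.RingSolver using (solve-∀)
  open PythagoreanTriple n d

  M N : ℤ
  M = + m
  N = + n

  pos-a : + a ≡ M * M - N * N
  pos-a = begin
    + a                               ≡⟨ cong +_ a-factors ⟩
    + (ℕ.suc d ℕ.* (m ℕ.+ n))         ≡⟨ pos-* (ℕ.suc d) (m ℕ.+ n) ⟩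
    + ℕ.suc d * + (m ℕ.+ n)           ≡⟨ cong (+ ℕ.suc d *_) (pos-+ m n) ⟩
    + ℕ.suc d * (M + N)               ≡⟨ lemma (+ n) (+ d) ⟩
    M * M - N * N                     ∎
    where
    open ≡-Reasoning
    lemma : ∀ n d → (1ℤ + d) * ((1ℤ + n + d) + n) ≡ (1ℤ + n + d) * (1ℤ + n + d) - n * n
    lemma = solve-∀

  pos-b : + b ≡ + 2 * M * N
  pos-b = trans (pos-* (2 ℕ.* m) n) (cong (_* N) (pos-* 2 m))

  pos-c : + c ≡ M * M + N * N
  pos-c = trans (pos-+ (m ℕ.^ 2) (n ℕ.^ 2)) (cong₂ _+_ (pos-square m) (pos-square n))

  instance
    norm-nonZero : NonZero (M * M + N * N)
    norm-nonZero = subst NonZero pos-c _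

  norm-coprime : ∀ k → ℕ.Coprime c (2 ℕ.* k) → Coprime (M * M + N * N) (+ 2 * + k)
  norm-coprime k = subst₂ ℕ.Coprime (cong ∣_∣ pos-c) (sym (abs-* (+ 2) (+ k)))

  module _ (cop : ℕ.Coprime m n) (par : m ℕ.% 2 ≢ n ℕ.% 2) where

    g-not-representable : ¬ Representable₃ a b c g
    g-not-representable (x , y , w , g≡) =
      no-small-multiple (gaussian-multiple M N U V W
        (norm-coprime m (c-coprime-2m cop par)) (norm-coprime n (c-coprime-2n cop par)) UVW≡)
      where
      L U V W : ℤ
      L = + (n ℕ.+ d)
      U = L - + x
      V = L - + y
      W = + ℕ.suc w
      below-M : ∀ t → L - + t < M
      below-M t = ≤-<-trans (i-j≤i L (+ t)) (+<+ (ℕ.n<1+n (n ℕ.+ d)))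
      rearrange : ∀ L x y w A B C → L * A + L * B - C ≡ x * A + y * B + w * C →
                  (L - x) * A + (L - y) * B ≡ (1ℤ + w) * C
      rearrange L x y w A B C eq =
        trans (ring₁ L x y A B C) (trans (cong (λ t → t + C - x * A - y * B) eq) (ring₂ x y w A B C))
        where
        ring₁ : ∀ L x y A B C → (L - x) * A + (L - y) * B ≡ L * A + L * B - C + C - x * A - y * B
        ring₁ = solve-∀
        ring₂ : ∀ x y w A B C → x * A + y * B + w * C + C - x * A - y * B ≡ (1ℤ + w) * C
        ring₂ = solve-∀
      UVW≡ : U * (M * M - N * N) + V * (+ 2 * M * N) ≡ W * (M * M + N * N)
      UVW≡ = begin
        U * (M * M - N * N) + V * (+ 2 * M * N) ≡⟨ cong₂ (λ s t → U * s + V * t) pos-a pos-b ⟨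
        U * + a + V * + b                       ≡⟨ rearrange L (+ x) (+ y) (+ w) (+ a) (+ b) (+ c)
                                                     (trans (cong (_- + c) (sym (pos-combination₂ (n ℕ.+ d) a (n ℕ.+ d) b))) g≡) ⟩
        W * + c                                 ≡⟨ cong (W *_) pos-c ⟩
        W * (M * M + N * N)                     ∎
        where open ≡-Reasoning
      no-small-multiple : ¬ (∃[ p ] ∃[ q ] U ≡ p * M - q * N × V ≡ p * N + q * M × W ≡ p * M + q * N)
      no-small-multiple (p , q , U≡ , V≡ , W≡)
        with subst (_≤ 0ℤ) (sym W≡) (gaussian-multiple-bound p q (ℕ.m≤n⇒m≤1+n (ℕ.m≤m+n n d))
               (subst (_< M) U≡ (below-M x)) (subst (_< M) V≡ (below-M y)))
      ... | +≤+ ()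

    reduced-representation : ∀ z → ∃[ x ] ∃[ y ] ∃[ s ] Reduced x y × z ≡ + x * + a + + y * + b + s * + c
    reduced-representation z =
      let x , k , z≡ = coprime⇒residue (a-coprime-c cop par) z
          x' , y' , j , reduced , xa≡ = reduce x 0 (s≤s z≤n)
      in x' , y' , + j + k , reduced , trans z≡ (lift-reduction x x' y' j k (trans (sym (ℕ.+-identityʳ (x ℕ.* a))) xa≡))
      where
      lift-reduction : ∀ x x' y' j k → x ℕ.* a ≡ x' ℕ.* a ℕ.+ y' ℕ.* b ℕ.+ j ℕ.* c →
                       + x * + a + k * + c ≡ + x' * + a + + y' * + b + (+ j + k) * + c
      lift-reduction x x' y' j k xa≡ = begin
        + x * + a + k * + c                                ≡⟨ cong (_+ k * + c) (pos-* x a) ⟨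
        + (x ℕ.* a) + k * + c                              ≡⟨ cong (λ t → + t + k * + c) xa≡ ⟩
        + (x' ℕ.* a ℕ.+ y' ℕ.* b ℕ.+ j ℕ.* c) + k * + c    ≡⟨ cong (_+ k * + c) (pos-combination₃ x' a y' b j c) ⟩
        + x' * + a + + y' * + b + + j * + c + k * + c      ≡⟨ collect (+ x' * + a + + y' * + b) (+ j) k (+ c) ⟩
        + x' * + a + + y' * + b + (+ j + k) * + c          ∎
        where
        open ≡-Reasoning
        collect : ∀ S j k C → S + j * C + k * C ≡ S + (j + k) * C
        collect = solve-∀

    below-g : ∀ {x y} w → Reduced x y → + x * + a + + y * + b + -[1+ w ] * + c ≤ g
    below-g {x} {y} w reduced = begin
      S + -[1+ w ] * + c              ≡⟨ expand S (+ w) (+ c) ⟩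
      S - + c - + w * + c             ≡⟨ cong (_-_ (S - + c)) (pos-* w c) ⟨
      S - + c - + (w ℕ.* c)           ≤⟨ i-j≤i (S - + c) (+ (w ℕ.* c)) ⟩
      S - + c                         ≡⟨ cong (_- + c) (pos-combination₂ x a y b) ⟨
      + (x ℕ.* a ℕ.+ y ℕ.* b) - + c   ≤⟨ +-monoˡ-≤ (- + c) (+≤+ (reduced-bound na≤[1+d]b reduced)) ⟩
      g                               ∎
      where
      open ≤-Reasoning
      S : ℤ
      S = + x * + a + + y * + b
      expand : ∀ S w C → S + - (1ℤ + w) * C ≡ S - C - w * C
      expand = solve-∀

    non-representable⇒≤g : ∀ z → ¬ Representable₃ a b c z → z ≤ g
    non-representable⇒≤g z z∉ = below-or-representable (reduced-representation z)
      where
      below-or-representable : ∃[ x ] ∃[ y ] ∃[ s ] Reduced x y × z ≡ + x * + a + + y * + b + s * + c → z ≤ g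
      below-or-representable (x , y , + w , _ , z≡) = contradiction (x , y , w , z≡) z∉
      below-or-representable (x , y , -[1+ w ] , reduced , z≡) = ≤-trans (≤-reflexive z≡) (below-g w reduced)

open import Data.Nat using (_<_; _≤_; _+_; _*_; _∸_; _^_)
open import Data.Nat.Properties using (m≤n⇒∃[o]m+o≡n)
open import Data.Nat.Coprimality using (Coprime)
open import Data.Nat.DivMod using (_%_)
open import Data.Integer using (+_; _-_)

mainTheorem1 : (m n : ℕ) → 1 ≤ n → n < m → Coprime m n → m % 2 ≢ n % 2 →
    IsFrobenius₃ (m ^ 2 ∸ n ^ 2) (2 * m * n) (m ^ 2 + n ^ 2)
      ((+ ((m ∸ 1) * (m ^ 2 ∸ n ^ 2) + (m ∸ 1) * (2 * m * n))) - (+ (m ^ 2 + n ^ 2)))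
mainTheorem1 m n _ n<m cop par with m≤n⇒∃[o]m+o≡n n<m
... | d , refl = g-not-representable cop par , non-representable⇒≤g cop par
  where open PythagoreanFrobenius n d
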